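{- Let $G$ and $H$ be graphs ($H$ with at least one vertex) and let $\mathcal{C}$ be a clique cover of $G$ with $|\mathcal{C}|=q$. Then $\big(D_i(H,x)\big)^{q-\alpha(G)}$ divides $D_i(G^{\Delta}(H),x)$.
   Context: All graphs are finite and simple. A set $S\subseteq V(G)$ is an independent dominating set of $G$ if no two vertices of $S$ are adjacent and every vertex of $V(G)\setminus S$ has a neighbour in $S$. $d_i(G,k)$ is the number of independent dominating sets of size $k$ and $D_i(G,x)=\sum_k d_i(G,k)x^k$. $\alpha(G)$ is the independence number of $G$. A clique cover of $G$ is a partition of $V(G)$ into cliques $C_1,\dots,C_q$. The compound graph $G^{\Delta}(H)$ (with respect to $\mathcal{C}$) is obtained from $G$ by adding, for each clique $C_j$, a new disjoint copy $H_j$ of $H$ and joining every vertex of $C_j$ to every vertex of $H_j$. -}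

module Defs where

open import Data.Nat using (ℕ; zero; suc; _+_; _*_; _∸_; _⊔_)
open import Data.Integer using (ℤ; +_) renaming (_+_ to _+ℤ_; _*_ to _*ℤ_)
open import Data.Bool using (Bool; true; false; _∧_; _∨_; not; if_then_else_)
open import Data.Bool.Properties using (∧-zeroʳ)
open import Data.Fin using (Fin; splitAt; remQuot) renaming (_≟_ to _≟F_)
open import Data.Sum using (_⊎_; inj₁; inj₂)
open import Data.Product using (_×_; _,_; ∃)
open import Data.List using (List; []; _∷_; [_]; _++_; map; filter; length; allFin; upTo; foldr)
open import Data.Vec using (Vec; []; _∷_; lookup)
open import Relation.Nullary.Decidable using (⌊_⌋; yes; no; T?)
open import Data.Bool.ListAction using (all; any)
open import Relation.Binary.PropositionalEquality using (_≡_; refl; sym; cong; cong₂)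

record Graph : Set where
  field
    n      : ℕ
    adj    : Fin n → Fin n → Bool
    adj-sym   : ∀ u v → adj u v ≡ adj v u
    adj-irrefl : ∀ u → adj u u ≡ false
open Graph public

_==F_ : ∀ {k} → Fin k → Fin k → Bool
i ==F j = ⌊ i ≟F j ⌋

==F-sym : ∀ {k} (i j : Fin k) → (i ==F j) ≡ (j ==F i)
==F-sym i j with i ≟F j | j ≟F i
... | yes _ | yes _ = refl
... | yes p | no ¬q = Data.Empty.⊥-elim (¬q (sym p)) where import Data.Empty
... | no ¬p | yes q = Data.Empty.⊥-elim (¬p (sym q)) where import Data.Empty
... | no _  | no _  = refl

Subset : ℕ → Set
Subset k = Vec Bool k

allSubsets : ∀ k → List (Subset k)
allSubsets zero    = [ [] ]
allSubsets (suc k) = map (true ∷_) (allSubsets k) ++ map (false ∷_) (allSubsets k)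

size : ∀ {k} → Subset k → ℕ
size []          = 0
size (true ∷ s)  = suc (size s)
size (false ∷ s) = size s

module _ (G : Graph) where
  private
    V = Fin (n G)
    _~_ = adj G

  isIndependent : Subset (n G) → Bool
  isIndependent S =
    all (λ u → all (λ v → not (lookup S u ∧ lookup S v ∧ (u ~ v))) (allFin (n G))) (allFin (n G))

  isDominating : Subset (n G) → Bool
  isDominating S =
    all (λ v → lookup S v ∨ any (λ u → lookup S u ∧ (u ~ v)) (allFin (n G))) (allFin (n G))

  isIndDom : Subset (n G) → Bool
  isIndDom S = isIndependent S ∧ isDominating S

  dᵢ : ℕ → ℕ
  dᵢ k = length (filter (λ S → T? (⌊ Data.Nat._≟_ (size S) k ⌋ ∧ isIndDom S)) (allSubsets (n G)))
    where import Data.Nat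

  α : ℕ
  α = foldr _⊔_ 0 (map size (filter (λ S → T? (isIndependent S)) (allSubsets (n G))))

-- Polynomials over ℤ as coefficient lists (constant term first)

Poly : Set
Poly = List ℤ

coeff : Poly → ℕ → ℤ
coeff []       _       = + 0
coeff (a ∷ p)  zero    = a
coeff (a ∷ p)  (suc k) = coeff p k

infixl 7 _*P_
_+P_ : Poly → Poly → Poly
[] +P q = q
(a ∷ p) +P [] = a ∷ p
(a ∷ p) +P (b ∷ q) = (a +ℤ b) ∷ (p +P q)

_*P_ : Poly → Poly → Poly
[] *P q = []
(a ∷ p) *P q = map (a *ℤ_) q +P (+ 0 ∷ (p *P q))

_^P_ : Poly → ℕ → Poly
p ^P zero  = + 1 ∷ []
p ^P suc k = p *P (p ^P k)

_∣P_ : Poly → Poly → Set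
p ∣P q = ∃ λ r → ∀ k → coeff q k ≡ coeff (p *P r) k

-- independent domination polynomial D_i(G,x) = Σ_k d_i(G,k) x^k  (k ranges over 0..|V(G)|)
Dᵢ : Graph → Poly
Dᵢ G = map (λ k → + dᵢ G k) (upTo (suc (n G)))

-- Clique covers: a partition of V(G) into q nonempty cliques C_0..C_{q-1},
-- given by the map c assigning each vertex its clique.

record CliqueCover (G : Graph) (q : ℕ) : Set where
  field
    cls      : Fin (n G) → Fin q
    nonempty : ∀ j → ∃ λ v → cls v ≡ j
    clique   : ∀ u v → cls u ≡ cls v → u ≡ v ⊎ adj G u v ≡ true
open CliqueCover public

-- Compound graph G^Δ(H): vertex set V(G) ⊎ (q copies of V(H)),
-- encoded as Fin (n G + q * n H) via splitAt / remQuot.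

module _ (G H : Graph) {q : ℕ} (𝒞 : CliqueCover G q) where
  private
    N = n G + q * n H
    Vtx = Fin (n G) ⊎ (Fin q × Fin (n H))

    dec : Fin N → Vtx
    dec i with splitAt (n G) i
    ... | inj₁ a = inj₁ a
    ... | inj₂ b = inj₂ (remQuot (n H) b)

    adjV : Vtx → Vtx → Bool
    adjV (inj₁ a) (inj₁ b) = adj G a b
    adjV (inj₁ a) (inj₂ (j , y)) = cls 𝒞 a ==F j
    adjV (inj₂ (j , x)) (inj₁ b) = cls 𝒞 b ==F j
    adjV (inj₂ (j , x)) (inj₂ (j' , y)) = (j ==F j') ∧ adj H x y

    adjV-sym : ∀ u v → adjV u v ≡ adjV v u
    adjV-sym (inj₁ a) (inj₁ b) = adj-sym G a b
    adjV-sym (inj₁ a) (inj₂ _) = refl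
    adjV-sym (inj₂ _) (inj₁ b) = refl
    adjV-sym (inj₂ (j , x)) (inj₂ (j' , y)) = cong₂ _∧_ (==F-sym j j') (adj-sym H x y)

    adjV-irr : ∀ u → adjV u u ≡ false
    adjV-irr (inj₁ a) = adj-irrefl G a
    adjV-irr (inj₂ (j , x)) rewrite adj-irrefl H x = ∧-zeroʳ (j ==F j)

  compound : Graph
  compound = record
    { n = N
    ; adj = λ u v → adjV (dec u) (dec v)
    ; adj-sym = λ u v → adjV-sym (dec u) (dec v)
    ; adj-irrefl = λ u → adjV-irr (dec u)
    }

module Submission where

-- An independent dominating set S of G^Δ(H) is described locally: A = S ∩ V(G)
-- must be independent in G; the part of S in the copy H_j must be empty when
-- A meets C_j (every vertex of H_j is adjacent to all of C_j), and must be an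
-- independent dominating set of H_j otherwise.  Summing over A therefore gives
--   Dᵢ(G^Δ(H), x) = Σ_{A independent in G} x^{|A|} Dᵢ(H, x)^{free(A)},
-- where free(A) is the number of cliques not met by A.  An independent set
-- meets at most |A| ≤ α(G) cliques, so free(A) ≥ q − α(G) and each summand is
-- divisible by Dᵢ(H, x)^{q − α(G)}.

open import Defs
open import Data.Nat using (ℕ; zero; suc; _+_; _*_; _∸_; _≤_; _<_; _⊔_; _≟_; _<?_; z≤n; s≤s)
open import Data.Nat.Properties using (≤-trans; ≤-refl; ≤-reflexive; m≤m⊔n; m≤n⊔m; n≤1+n; <-irrefl; ≤-<-trans; ≮⇒≥; +-mono-≤; +-suc; ∸-monoʳ-≤; m+[n∸m]≡n; m+n∸n≡m)
open import Data.Integer using (ℤ; +_; +0) renaming (_+_ to _+ℤ_; _*_ to _*ℤ_)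
open import Data.Integer.Properties using (+-identityˡ; +-identityʳ; +-assoc; *-zeroʳ; *-identityˡ; *-distribˡ-+; *-distribʳ-+)
open import Data.Integer.Tactic.RingSolver using (solve-∀)
open import Data.Bool using (Bool; true; false; _∧_; _∨_; not; if_then_else_; T)
open import Data.Bool.Properties using (∧-zeroʳ)
open import Data.Bool.ListAction using (all; any)
open import Data.List using (List; []; _∷_; map; _++_; filter; length; applyUpTo; foldr; tabulate)
open import Data.List.Properties using (map-++; ++-assoc; ++-identityʳ)
open import Data.List.Membership.Propositional using (_∈_)
open import Data.List.Membership.Propositional.Properties using (∈-map⁺; ∈-++⁺ˡ; ∈-++⁺ʳ; ∈-filter⁺)
open import Data.List.Relation.Unary.Any using (here; there)
open import Data.Vec using (Vec; []; _∷_; lookup; take; drop; concat) renaming (_++_ to _++V_)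
import Data.Vec as Vec
open import Data.Vec.Properties using (take++drop≡id; ++-injectiveˡ; ++-injectiveʳ; lookup-concat; lookup-splitAt)
open import Data.Fin using (Fin; zero; suc; splitAt; join; remQuot; combine) renaming (_≟_ to _≟F_)
open import Data.Fin.Properties using (splitAt-join; remQuot-combine; combine-remQuot)
open import Data.Sum using (_⊎_; inj₁; inj₂; [_,_]′)
open import Data.Product using (_×_; _,_; proj₁; proj₂; ∃; uncurry)
open import Data.Unit using (tt)
open import Data.Empty using (⊥-elim)
open import Function using (_∘_; id; _⇔_; mk⇔)
open import Function.Bundles using (module Equivalence)
open import Relation.Nullary using (¬_)
open import Relation.Nullary.Decidable using (⌊_⌋; yes; no; T?)
open import Relation.Binary.Bundles using (Setoid)
import Relation.Binary.Reasoning.Setoid as SetoidReasoning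
open import Relation.Binary.PropositionalEquality using (_≡_; refl; sym; trans; cong; cong₂; subst; module ≡-Reasoning)

open Equivalence using (to; from)

infix 4 _≈P_

-- Equality of polynomials: all coefficients agree, so trailing zeros are
-- irrelevant.  Divisibility `∣P` is phrased in exactly these terms.
record _≈P_ (p q : Poly) : Set where
  constructor coeffwise
  field coeff-≡ : ∀ k → coeff p k ≡ coeff q k
open _≈P_

≈P-setoid : Setoid _ _
≈P-setoid = record
  { Carrier = Poly
  ; _≈_ = _≈P_
  ; isEquivalence = record
    { refl = coeffwise λ _ → refl
    ; sym = λ e → coeffwise λ k → sym (e .coeff-≡ k)
    ; trans = λ e f → coeffwise λ k → trans (e .coeff-≡ k) (f .coeff-≡ k)
    }
  }

module ≈P-Reasoning = SetoidReasoning ≈P-setoid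
open Setoid ≈P-setoid using () renaming (refl to ≈P-refl; sym to ≈P-sym; trans to ≈P-trans; reflexive to ≈P-reflexive)

coeff-+P : ∀ p q k → coeff (p +P q) k ≡ coeff p k +ℤ coeff q k
coeff-+P []      q       k       = sym (+-identityˡ _)
coeff-+P (a ∷ p) []      k       = sym (+-identityʳ _)
coeff-+P (a ∷ p) (b ∷ q) zero    = refl
coeff-+P (a ∷ p) (b ∷ q) (suc k) = coeff-+P p q k

coeff-scale : ∀ a q k → coeff (map (a *ℤ_) q) k ≡ a *ℤ coeff q k
coeff-scale a []      k       = sym (*-zeroʳ a)
coeff-scale a (b ∷ q) zero    = refl
coeff-scale a (b ∷ q) (suc k) = coeff-scale a q k

coeff-*P : ∀ a p q k → coeff ((a ∷ p) *P q) k ≡ a *ℤ coeff q k +ℤ coeff (+0 ∷ (p *P q)) k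
coeff-*P a p q k = trans (coeff-+P (map (a *ℤ_) q) _ k) (cong (_+ℤ _) (coeff-scale a q k))

∷-cong : ∀ {a b p q} → a ≡ b → p ≈P q → (a ∷ p) ≈P (b ∷ q)
∷-cong e f .coeff-≡ zero    = e
∷-cong e f .coeff-≡ (suc k) = f .coeff-≡ k

+P-assoc : ∀ p q r → (p +P q) +P r ≈P p +P (q +P r)
+P-assoc p q r .coeff-≡ k = begin
  coeff ((p +P q) +P r) k                  ≡⟨ coeff-+P (p +P q) r k ⟩
  coeff (p +P q) k +ℤ coeff r k            ≡⟨ cong (_+ℤ coeff r k) (coeff-+P p q k) ⟩
  coeff p k +ℤ coeff q k +ℤ coeff r k      ≡⟨ +-assoc (coeff p k) (coeff q k) (coeff r k) ⟩
  coeff p k +ℤ (coeff q k +ℤ coeff r k)    ≡⟨ cong (coeff p k +ℤ_) (coeff-+P q r k) ⟨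
  coeff p k +ℤ coeff (q +P r) k            ≡⟨ coeff-+P p (q +P r) k ⟨
  coeff (p +P (q +P r)) k                  ∎
  where open ≡-Reasoning

+P-cong : ∀ {p p' q q'} → p ≈P p' → q ≈P q' → p +P q ≈P p' +P q'
+P-cong {p} {p'} {q} {q'} e f .coeff-≡ k = begin
  coeff (p +P q) k          ≡⟨ coeff-+P p q k ⟩
  coeff p k +ℤ coeff q k    ≡⟨ cong₂ _+ℤ_ (e .coeff-≡ k) (f .coeff-≡ k) ⟩
  coeff p' k +ℤ coeff q' k  ≡⟨ coeff-+P p' q' k ⟨
  coeff (p' +P q') k        ∎
  where open ≡-Reasoning

*P-congʳ : ∀ p {q q'} → q ≈P q' → p *P q ≈P p *P q'
*P-congʳ []      e .coeff-≡ k = refl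
*P-congʳ (a ∷ p) {q} {q'} e .coeff-≡ k = begin
  coeff ((a ∷ p) *P q) k                               ≡⟨ coeff-*P a p q k ⟩
  a *ℤ coeff q k +ℤ coeff (+0 ∷ (p *P q)) k            ≡⟨ cong₂ _+ℤ_ (cong (a *ℤ_) (e .coeff-≡ k)) (∷-cong refl (*P-congʳ p e) .coeff-≡ k) ⟩
  a *ℤ coeff q' k +ℤ coeff (+0 ∷ (p *P q')) k          ≡⟨ coeff-*P a p q' k ⟨
  coeff ((a ∷ p) *P q') k                              ∎
  where open ≡-Reasoning

*P-zeroˡ : ∀ p q → p ≈P [] → p *P q ≈P []
*P-zeroˡ []      q e .coeff-≡ k = refl
*P-zeroˡ (a ∷ p) q e .coeff-≡ k = begin
  coeff ((a ∷ p) *P q) k                       ≡⟨ coeff-*P a p q k ⟩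
  a *ℤ coeff q k +ℤ coeff (+0 ∷ (p *P q)) k    ≡⟨ cong₂ _+ℤ_ (cong (_*ℤ coeff q k) (e .coeff-≡ 0)) (∷-cong refl (*P-zeroˡ p q (coeffwise λ j → e .coeff-≡ (suc j))) .coeff-≡ k) ⟩
  +0 *ℤ coeff q k +ℤ coeff (+0 ∷ []) k         ≡⟨ vanish k ⟩
  coeff [] k                                   ∎
  where
  open ≡-Reasoning
  vanish : ∀ k → +0 *ℤ coeff q k +ℤ coeff (+0 ∷ []) k ≡ coeff [] k
  vanish zero    = refl
  vanish (suc k) = refl

*P-congˡ : ∀ p p' q → p ≈P p' → p *P q ≈P p' *P q
*P-congˡ []      p'       q e .coeff-≡ k = sym (*P-zeroˡ p' q (coeffwise λ j → sym (e .coeff-≡ j)) .coeff-≡ k)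
*P-congˡ (a ∷ p) []       q e   = *P-zeroˡ (a ∷ p) q e
*P-congˡ (a ∷ p) (b ∷ p') q e .coeff-≡ k = begin
  coeff ((a ∷ p) *P q) k                       ≡⟨ coeff-*P a p q k ⟩
  a *ℤ coeff q k +ℤ coeff (+0 ∷ (p *P q)) k    ≡⟨ cong₂ _+ℤ_ (cong (_*ℤ coeff q k) (e .coeff-≡ 0)) (∷-cong refl (*P-congˡ p p' q (coeffwise λ j → e .coeff-≡ (suc j))) .coeff-≡ k) ⟩
  b *ℤ coeff q k +ℤ coeff (+0 ∷ (p' *P q)) k   ≡⟨ coeff-*P b p' q k ⟨
  coeff ((b ∷ p') *P q) k                      ∎
  where open ≡-Reasoning

+ℤ-interchange : ∀ (a b c d : ℤ) → (a +ℤ b) +ℤ (c +ℤ d) ≡ (a +ℤ c) +ℤ (b +ℤ d)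
+ℤ-interchange = solve-∀

*P-distribˡ : ∀ p q r → p *P (q +P r) ≈P (p *P q) +P (p *P r)
*P-distribˡ []      q r .coeff-≡ k = refl
*P-distribˡ (a ∷ p) q r .coeff-≡ k = begin
  coeff ((a ∷ p) *P (q +P r)) k
    ≡⟨ coeff-*P a p (q +P r) k ⟩
  a *ℤ coeff (q +P r) k +ℤ coeff (+0 ∷ (p *P (q +P r))) k
    ≡⟨ cong₂ _+ℤ_ (cong (a *ℤ_) (coeff-+P q r k)) (∷-cong refl (*P-distribˡ p q r) .coeff-≡ k) ⟩
  a *ℤ (coeff q k +ℤ coeff r k) +ℤ coeff ((+0 ∷ (p *P q)) +P (+0 ∷ (p *P r))) k
    ≡⟨ cong₂ _+ℤ_ (*-distribˡ-+ a (coeff q k) (coeff r k)) (coeff-+P (+0 ∷ (p *P q)) (+0 ∷ (p *P r)) k) ⟩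
  (a *ℤ coeff q k +ℤ a *ℤ coeff r k) +ℤ (coeff (+0 ∷ (p *P q)) k +ℤ coeff (+0 ∷ (p *P r)) k)
    ≡⟨ +ℤ-interchange (a *ℤ coeff q k) (a *ℤ coeff r k) (coeff (+0 ∷ (p *P q)) k) (coeff (+0 ∷ (p *P r)) k) ⟩
  (a *ℤ coeff q k +ℤ coeff (+0 ∷ (p *P q)) k) +ℤ (a *ℤ coeff r k +ℤ coeff (+0 ∷ (p *P r)) k)
    ≡⟨ cong₂ _+ℤ_ (coeff-*P a p q k) (coeff-*P a p r k) ⟨
  coeff ((a ∷ p) *P q) k +ℤ coeff ((a ∷ p) *P r) k
    ≡⟨ coeff-+P ((a ∷ p) *P q) _ k ⟨
  coeff (((a ∷ p) *P q) +P ((a ∷ p) *P r)) k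
    ∎
  where open ≡-Reasoning

*P-distribʳ : ∀ p p' q → (p +P p') *P q ≈P (p *P q) +P (p' *P q)
*P-distribʳ []      p'       q .coeff-≡ k = refl
*P-distribʳ (a ∷ p) []       q .coeff-≡ k = sym (trans (coeff-+P ((a ∷ p) *P q) [] k) (+-identityʳ _))
*P-distribʳ (a ∷ p) (b ∷ p') q .coeff-≡ k = begin
  coeff (((a +ℤ b) ∷ (p +P p')) *P q) k
    ≡⟨ coeff-*P (a +ℤ b) (p +P p') q k ⟩
  (a +ℤ b) *ℤ coeff q k +ℤ coeff (+0 ∷ ((p +P p') *P q)) k
    ≡⟨ cong ((a +ℤ b) *ℤ coeff q k +ℤ_) (∷-cong refl (*P-distribʳ p p' q) .coeff-≡ k) ⟩
  (a +ℤ b) *ℤ coeff q k +ℤ coeff ((+0 ∷ (p *P q)) +P (+0 ∷ (p' *P q))) k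
    ≡⟨ cong₂ _+ℤ_ (*-distribʳ-+ (coeff q k) a b) (coeff-+P (+0 ∷ (p *P q)) (+0 ∷ (p' *P q)) k) ⟩
  (a *ℤ coeff q k +ℤ b *ℤ coeff q k) +ℤ (coeff (+0 ∷ (p *P q)) k +ℤ coeff (+0 ∷ (p' *P q)) k)
    ≡⟨ +ℤ-interchange (a *ℤ coeff q k) (b *ℤ coeff q k) (coeff (+0 ∷ (p *P q)) k) (coeff (+0 ∷ (p' *P q)) k) ⟩
  (a *ℤ coeff q k +ℤ coeff (+0 ∷ (p *P q)) k) +ℤ (b *ℤ coeff q k +ℤ coeff (+0 ∷ (p' *P q)) k)
    ≡⟨ cong₂ _+ℤ_ (coeff-*P a p q k) (coeff-*P b p' q k) ⟨
  coeff ((a ∷ p) *P q) k +ℤ coeff ((b ∷ p') *P q) k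
    ≡⟨ coeff-+P ((a ∷ p) *P q) _ k ⟨
  coeff (((a ∷ p) *P q) +P ((b ∷ p') *P q)) k
    ∎
  where open ≡-Reasoning

scale-*P : ∀ a q r → map (a *ℤ_) q *P r ≈P map (a *ℤ_) (q *P r)
scale-*P a []      r .coeff-≡ k = refl
scale-*P a (b ∷ q) r .coeff-≡ k = begin
  coeff ((a *ℤ b ∷ map (a *ℤ_) q) *P r) k
    ≡⟨ coeff-*P (a *ℤ b) (map (a *ℤ_) q) r k ⟩
  a *ℤ b *ℤ coeff r k +ℤ coeff (+0 ∷ (map (a *ℤ_) q *P r)) k
    ≡⟨ cong (a *ℤ b *ℤ coeff r k +ℤ_) (∷-cong (sym (*-zeroʳ a)) (scale-*P a q r) .coeff-≡ k) ⟩
  a *ℤ b *ℤ coeff r k +ℤ coeff (map (a *ℤ_) (+0 ∷ (q *P r))) k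
    ≡⟨ cong (a *ℤ b *ℤ coeff r k +ℤ_) (coeff-scale a (+0 ∷ (q *P r)) k) ⟩
  a *ℤ b *ℤ coeff r k +ℤ a *ℤ coeff (+0 ∷ (q *P r)) k
    ≡⟨ factor a b (coeff r k) (coeff (+0 ∷ (q *P r)) k) ⟩
  a *ℤ (b *ℤ coeff r k +ℤ coeff (+0 ∷ (q *P r)) k)
    ≡⟨ cong (a *ℤ_) (coeff-*P b q r k) ⟨
  a *ℤ coeff ((b ∷ q) *P r) k
    ≡⟨ coeff-scale a ((b ∷ q) *P r) k ⟨
  coeff (map (a *ℤ_) ((b ∷ q) *P r)) k
    ∎
  where
  open ≡-Reasoning
  factor : ∀ (a b c d : ℤ) → a *ℤ b *ℤ c +ℤ a *ℤ d ≡ a *ℤ (b *ℤ c +ℤ d)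
  factor = solve-∀

x*P : ∀ p r → (+0 ∷ p) *P r ≈P (+0 ∷ (p *P r))
x*P p r .coeff-≡ k = trans (coeff-*P +0 p r k) (+-identityˡ _)

*P-assoc : ∀ p q r → (p *P q) *P r ≈P p *P (q *P r)
*P-assoc []      q r = ≈P-refl
*P-assoc (a ∷ p) q r = begin
  (map (a *ℤ_) q +P (+0 ∷ (p *P q))) *P r               ≈⟨ *P-distribʳ (map (a *ℤ_) q) (+0 ∷ (p *P q)) r ⟩
  (map (a *ℤ_) q *P r) +P ((+0 ∷ (p *P q)) *P r)        ≈⟨ +P-cong (scale-*P a q r) (x*P (p *P q) r) ⟩
  map (a *ℤ_) (q *P r) +P (+0 ∷ ((p *P q) *P r))        ≈⟨ +P-cong ≈P-refl (∷-cong refl (*P-assoc p q r)) ⟩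
  map (a *ℤ_) (q *P r) +P (+0 ∷ (p *P (q *P r)))        ∎
  where open ≈P-Reasoning

*P-identityˡ : ∀ q → (+ 1 ∷ []) *P q ≈P q
*P-identityˡ q .coeff-≡ k = begin
  coeff ((+ 1 ∷ []) *P q) k                     ≡⟨ coeff-*P (+ 1) [] q k ⟩
  + 1 *ℤ coeff q k +ℤ coeff (+0 ∷ []) k         ≡⟨ cong₂ _+ℤ_ (*-identityˡ (coeff q k)) (coeff-zero k) ⟩
  coeff q k +ℤ +0                               ≡⟨ +-identityʳ (coeff q k) ⟩
  coeff q k                                     ∎
  where
  open ≡-Reasoning
  coeff-zero : ∀ k → coeff (+0 ∷ []) k ≡ +0
  coeff-zero zero    = refl
  coeff-zero (suc k) = refl

*P-zeroʳ : ∀ p → p *P [] ≈P []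
*P-zeroʳ []      .coeff-≡ k       = refl
*P-zeroʳ (a ∷ p) .coeff-≡ zero    = refl
*P-zeroʳ (a ∷ p) .coeff-≡ (suc k) = *P-zeroʳ p .coeff-≡ k

*P-x : ∀ p q → p *P (+0 ∷ q) ≈P (+0 ∷ (p *P q))
*P-x []      q .coeff-≡ zero    = refl
*P-x []      q .coeff-≡ (suc k) = refl
*P-x (a ∷ p) q .coeff-≡ zero    = trans (coeff-*P a p (+0 ∷ q) zero) (trans (+-identityʳ _) (*-zeroʳ a))
*P-x (a ∷ p) q .coeff-≡ (suc k) = begin
  coeff ((a ∷ p) *P (+0 ∷ q)) (suc k)           ≡⟨ coeff-*P a p (+0 ∷ q) (suc k) ⟩
  a *ℤ coeff q k +ℤ coeff (p *P (+0 ∷ q)) k     ≡⟨ cong (a *ℤ coeff q k +ℤ_) (*P-x p q .coeff-≡ k) ⟩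
  a *ℤ coeff q k +ℤ coeff (+0 ∷ (p *P q)) k     ≡⟨ coeff-*P a p q k ⟨
  coeff ((a ∷ p) *P q) k                        ∎
  where open ≡-Reasoning

monomial : ℕ → Poly
monomial zero    = + 1 ∷ []
monomial (suc a) = +0 ∷ monomial a

shiftP : ℕ → Poly → Poly
shiftP zero    p = p
shiftP (suc a) p = +0 ∷ shiftP a p

shiftP-cong : ∀ a {p q} → p ≈P q → shiftP a p ≈P shiftP a q
shiftP-cong zero    e = e
shiftP-cong (suc a) e = ∷-cong refl (shiftP-cong a e)

monomial-*P : ∀ a q → monomial a *P q ≈P shiftP a q
monomial-*P zero    q = *P-identityˡ q
monomial-*P (suc a) q = begin
  (+0 ∷ monomial a) *P q      ≈⟨ x*P (monomial a) q ⟩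
  +0 ∷ (monomial a *P q)      ≈⟨ ∷-cong refl (monomial-*P a q) ⟩
  +0 ∷ shiftP a q             ∎
  where open ≈P-Reasoning

shiftP-*P : ∀ a p q → shiftP a (p *P q) ≈P p *P shiftP a q
shiftP-*P zero    p q = ≈P-refl
shiftP-*P (suc a) p q = begin
  +0 ∷ shiftP a (p *P q)      ≈⟨ ∷-cong refl (shiftP-*P a p q) ⟩
  +0 ∷ (p *P shiftP a q)      ≈⟨ *P-x p (shiftP a q) ⟨
  p *P (+0 ∷ shiftP a q)      ∎
  where open ≈P-Reasoning

^P-+ : ∀ p m t → p ^P (m + t) ≈P (p ^P m) *P (p ^P t)
^P-+ p zero    t = ≈P-sym (*P-identityˡ (p ^P t))
^P-+ p (suc m) t = begin
  p *P (p ^P (m + t))             ≈⟨ *P-congʳ p (^P-+ p m t) ⟩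
  p *P ((p ^P m) *P (p ^P t))     ≈⟨ *P-assoc p (p ^P m) (p ^P t) ⟨
  (p *P (p ^P m)) *P (p ^P t)     ∎
  where open ≈P-Reasoning

gen : {X : Set} → (X → Bool) → (X → ℕ) → List X → Poly
gen f w []      = []
gen f w (x ∷ L) = if f x then monomial (w x) +P gen f w L else gen f w L

coeff-monomial-≡ : ∀ a → coeff (monomial a) a ≡ + 1
coeff-monomial-≡ zero    = refl
coeff-monomial-≡ (suc a) = coeff-monomial-≡ a

coeff-monomial-≢ : ∀ a k → ¬ (a ≡ k) → coeff (monomial a) k ≡ +0
coeff-monomial-≢ zero    zero    a≢k = ⊥-elim (a≢k refl)
coeff-monomial-≢ zero    (suc k) a≢k = refl
coeff-monomial-≢ (suc a) zero    a≢k = refl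
coeff-monomial-≢ (suc a) (suc k) a≢k = coeff-monomial-≢ a k (a≢k ∘ cong suc)

coeff-gen : {X : Set} (f : X → Bool) (w : X → ℕ) (L : List X) (k : ℕ) →
  coeff (gen f w L) k ≡ + length (filter (λ x → T? (⌊ w x ≟ k ⌋ ∧ f x)) L)
coeff-gen f w []      k = refl
coeff-gen f w (x ∷ L) k with f x | w x ≟ k
... | false | yes _   = coeff-gen f w L k
... | false | no _    = coeff-gen f w L k
... | true  | yes refl = trans (coeff-+P (monomial (w x)) (gen f w L) k)
                               (cong₂ _+ℤ_ (coeff-monomial-≡ (w x)) (coeff-gen f w L k))
... | true  | no w≢k  = trans (coeff-+P (monomial (w x)) (gen f w L) k)
                               (trans (cong₂ _+ℤ_ (coeff-monomial-≢ (w x) k w≢k) (coeff-gen f w L k)) (+-identityˡ _))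

module _ {X : Set} where

  gen-++ : (f : X → Bool) (w : X → ℕ) (L L' : List X) → gen f w (L ++ L') ≈P gen f w L +P gen f w L'
  gen-++ f w []      L' = ≈P-refl
  gen-++ f w (x ∷ L) L' with f x
  ... | true  = ≈P-trans (+P-cong ≈P-refl (gen-++ f w L L')) (≈P-sym (+P-assoc (monomial (w x)) (gen f w L) (gen f w L')))
  ... | false = gen-++ f w L L'

  gen-ext : {f f' : X → Bool} {w w' : X → ℕ} (L : List X) →
    (∀ x → f x ≡ f' x) → (∀ x → w x ≡ w' x) → gen f w L ≡ gen f' w' L
  gen-ext []      ef ew = refl
  gen-ext (x ∷ L) ef ew rewrite ef x | ew x | gen-ext L ef ew = refl

  gen-none : (f : X → Bool) (w : X → ℕ) (L : List X) → (∀ x → f x ≡ false) → gen f w L ≡ []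
  gen-none f w []      none = refl
  gen-none f w (x ∷ L) none rewrite none x = gen-none f w L none

  gen-shift : (f : X → Bool) (a : ℕ) (w : X → ℕ) (L : List X) → gen f (λ y → a + w y) L ≈P shiftP a (gen f w L)
  gen-shift f zero    w L = ≈P-refl
  gen-shift f (suc a) w L = ≈P-trans (gen-suc (λ y → a + w y) L) (∷-cong refl (gen-shift f a w L))
    where
    gen-suc : (v : X → ℕ) (L : List X) → gen f (suc ∘ v) L ≈P (+0 ∷ gen f v L)
    gen-suc v []      = coeffwise λ { zero → refl ; (suc k) → refl }
    gen-suc v (x ∷ L) with f x
    ... | false = gen-suc v L
    ... | true  = +P-cong (≈P-refl {monomial (suc (v x))}) (gen-suc v L)

gen-map : {X Y : Set} (f : Y → Bool) (w : Y → ℕ) (g : X → Y) (L : List X) → gen f w (map g L) ≡ gen (f ∘ g) (w ∘ g) L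
gen-map f w g []      = refl
gen-map f w g (x ∷ L) rewrite gen-map f w g L = refl

sumP : {X : Set} → (X → Poly) → List X → Poly
sumP h []      = []
sumP h (x ∷ L) = h x +P sumP h L

sumP-cong : {X : Set} {h h' : X → Poly} (L : List X) → (∀ x → h x ≈P h' x) → sumP h L ≈P sumP h' L
sumP-cong []      e = ≈P-refl
sumP-cong (x ∷ L) e = +P-cong (e x) (sumP-cong L e)

sumP-factor : {X : Set} (p : Poly) (h : X → Poly) (L : List X) → sumP (λ x → p *P h x) L ≈P p *P sumP h L
sumP-factor p h []      = ≈P-sym (*P-zeroʳ p)
sumP-factor p h (x ∷ L) = ≈P-trans (+P-cong ≈P-refl (sumP-factor p h L)) (≈P-sym (*P-distribˡ p (h x) (sumP h L)))

pairs : {X Y : Set} → List X → List Y → List (X × Y)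
pairs []       L2 = []
pairs (x ∷ L1) L2 = map (x ,_) L2 ++ pairs L1 L2

pairs-++ : {X Y : Set} (L L' : List X) (M : List Y) → pairs (L ++ L') M ≡ pairs L M ++ pairs L' M
pairs-++ []      L' M = refl
pairs-++ (x ∷ L) L' M = trans (cong (map (x ,_) M ++_) (pairs-++ L L' M)) (sym (++-assoc (map (x ,_) M) (pairs L M) (pairs L' M)))

module _ {X Y : Set} (f : X → Bool) (w : X → ℕ) where

  gen-pairs : (g : X → Y → Bool) (v : Y → ℕ) (L1 : List X) (L2 : List Y) →
    gen (λ xy → f (proj₁ xy) ∧ g (proj₁ xy) (proj₂ xy)) (λ xy → w (proj₁ xy) + v (proj₂ xy)) (pairs L1 L2)
      ≈P sumP (λ x → if f x then shiftP (w x) (gen (g x) v L2) else []) L1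
  gen-pairs g v []       L2 = ≈P-refl
  gen-pairs g v (x ∷ L1) L2 = begin
    gen F W (map (x ,_) L2 ++ pairs L1 L2)                ≈⟨ gen-++ F W (map (x ,_) L2) (pairs L1 L2) ⟩
    gen F W (map (x ,_) L2) +P gen F W (pairs L1 L2)      ≡⟨ cong (_+P gen F W (pairs L1 L2)) (gen-map F W (x ,_) L2) ⟩
    gen (λ y → f x ∧ g x y) (λ y → w x + v y) L2 +P gen F W (pairs L1 L2)
                                                          ≈⟨ +P-cong row (gen-pairs g v L1 L2) ⟩
    sumP term (x ∷ L1)                                    ∎
    where
    open ≈P-Reasoning
    F = λ (xy : X × Y) → f (proj₁ xy) ∧ g (proj₁ xy) (proj₂ xy)
    W = λ (xy : X × Y) → w (proj₁ xy) + v (proj₂ xy)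
    term = λ x → if f x then shiftP (w x) (gen (g x) v L2) else []
    row : gen (λ y → f x ∧ g x y) (λ y → w x + v y) L2 ≈P term x
    row with f x
    ... | true  = gen-shift (g x) (w x) v L2
    ... | false = ≈P-reflexive (gen-none (λ _ → false) (λ y → w x + v y) L2 (λ _ → refl))

  gen-pairs-× : (f' : Y → Bool) (v : Y → ℕ) (L1 : List X) (L2 : List Y) →
    gen (λ xy → f (proj₁ xy) ∧ f' (proj₂ xy)) (λ xy → w (proj₁ xy) + v (proj₂ xy)) (pairs L1 L2)
      ≈P gen f w L1 *P gen f' v L2
  gen-pairs-× f' v L1 L2 = ≈P-trans (gen-pairs (λ _ → f') v L1 L2) (sum-as-product L1)
    where
    G = gen f' v L2
    sum-as-product : ∀ L1 → sumP (λ x → if f x then shiftP (w x) G else []) L1 ≈P gen f w L1 *P G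
    sum-as-product []       = ≈P-refl
    sum-as-product (x ∷ L1) with f x
    ... | false = sum-as-product L1
    ... | true  = ≈P-trans (+P-cong (≈P-sym (monomial-*P (w x) G)) (sum-as-product L1))
                           (≈P-sym (*P-distribʳ (monomial (w x)) (gen f w L1) G))

append : ∀ {a b} → Subset a × Subset b → Subset (a + b)
append = uncurry _++V_

append-pairs-∷ : ∀ {a b} (c : Bool) (As : List (Subset a)) (Bs : List (Subset b)) →
  map append (pairs (map (c ∷_) As) Bs) ≡ map (c ∷_) (map append (pairs As Bs))
append-pairs-∷ c []       Bs = refl
append-pairs-∷ c (A ∷ As) Bs = begin
  map append (map ((c ∷ A) ,_) Bs ++ pairs (map (c ∷_) As) Bs)
    ≡⟨ map-++ append (map ((c ∷ A) ,_) Bs) _ ⟩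
  map append (map ((c ∷ A) ,_) Bs) ++ map append (pairs (map (c ∷_) As) Bs)
    ≡⟨ cong₂ _++_ (row Bs) (append-pairs-∷ c As Bs) ⟩
  map (c ∷_) (map append (map (A ,_) Bs)) ++ map (c ∷_) (map append (pairs As Bs))
    ≡⟨ map-++ (c ∷_) (map append (map (A ,_) Bs)) _ ⟨
  map (c ∷_) (map append (map (A ,_) Bs) ++ map append (pairs As Bs))
    ≡⟨ cong (map (c ∷_)) (map-++ append (map (A ,_) Bs) _) ⟨
  map (c ∷_) (map append (pairs (A ∷ As) Bs))
    ∎
  where
  open ≡-Reasoning
  row : ∀ Bs → map append (map ((c ∷ A) ,_) Bs) ≡ map (c ∷_) (map append (map (A ,_) Bs))
  row []       = refl
  row (B ∷ Bs) = cong (_ ∷_) (row Bs)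

allSubsets-+ : ∀ a b → allSubsets (a + b) ≡ map append (pairs (allSubsets a) (allSubsets b))
allSubsets-+ zero    b = sym (trans (cong (map append) (++-identityʳ _)) (empty-prefix (allSubsets b)))
  where
  empty-prefix : ∀ (Bs : List (Subset b)) → map append (map ([] ,_) Bs) ≡ Bs
  empty-prefix []       = refl
  empty-prefix (B ∷ Bs) = cong (B ∷_) (empty-prefix Bs)
allSubsets-+ (suc a) b = begin
  map (true ∷_) (allSubsets (a + b)) ++ map (false ∷_) (allSubsets (a + b))
    ≡⟨ cong₂ _++_ (cong (map (true ∷_)) (allSubsets-+ a b)) (cong (map (false ∷_)) (allSubsets-+ a b)) ⟩
  map (true ∷_) (map append (pairs As Bs)) ++ map (false ∷_) (map append (pairs As Bs))
    ≡⟨ cong₂ _++_ (append-pairs-∷ true As Bs) (append-pairs-∷ false As Bs) ⟨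
  map append (pairs (map (true ∷_) As) Bs) ++ map append (pairs (map (false ∷_) As) Bs)
    ≡⟨ map-++ append (pairs (map (true ∷_) As) Bs) _ ⟨
  map append (pairs (map (true ∷_) As) Bs ++ pairs (map (false ∷_) As) Bs)
    ≡⟨ cong (map append) (pairs-++ (map (true ∷_) As) _ Bs) ⟨
  map append (pairs (map (true ∷_) As ++ map (false ∷_) As) Bs)
    ∎
  where
  open ≡-Reasoning
  As = allSubsets a
  Bs = allSubsets b

size-++ : ∀ {a b} (A : Subset a) (B : Subset b) → size (A ++V B) ≡ size A + size B
size-++ []          B = refl
size-++ (true ∷ A)  B = cong suc (size-++ A B)
size-++ (false ∷ A) B = size-++ A B

size-≤ : ∀ {k} (A : Subset k) → size A ≤ k
size-≤ []          = z≤n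
size-≤ (true ∷ A)  = s≤s (size-≤ A)
size-≤ (false ∷ A) = ≤-trans (size-≤ A) (n≤1+n _)

allSubsets-complete : ∀ {k} (A : Subset k) → A ∈ allSubsets k
allSubsets-complete []                = here refl
allSubsets-complete {suc k} (true ∷ A)  = ∈-++⁺ˡ (∈-map⁺ (true ∷_) (allSubsets-complete A))
allSubsets-complete {suc k} (false ∷ A) = ∈-++⁺ʳ (map (true ∷_) (allSubsets k)) (∈-map⁺ (false ∷_) (allSubsets-complete A))

foldr-⊔-upper : ∀ {x} (xs : List ℕ) → x ∈ xs → x ≤ foldr _⊔_ 0 xs
foldr-⊔-upper (y ∷ xs) (here refl) = m≤m⊔n y _
foldr-⊔-upper (y ∷ xs) (there x∈xs) = ≤-trans (foldr-⊔-upper xs x∈xs) (m≤n⊔m y _)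

α-bound : (G : Graph) (A : Subset (n G)) → isIndependent G A ≡ true → size A ≤ α G
α-bound G A ind = foldr-⊔-upper _ (∈-map⁺ size (∈-filter⁺ (λ S → T? (isIndependent G S)) (allSubsets-complete A) (T-true ind)))
  where
  T-true : ∀ {b} → b ≡ true → T b
  T-true refl = tt

coeff-applyUpTo-< : (g : ℕ → ℤ) (f : ℕ → ℕ) (m k : ℕ) → k < m → coeff (map g (applyUpTo f m)) k ≡ g (f k)
coeff-applyUpTo-< g f (suc m) zero    _         = refl
coeff-applyUpTo-< g f (suc m) (suc k) (s≤s k<m) = coeff-applyUpTo-< g (f ∘ suc) m k k<m

coeff-applyUpTo-≥ : (g : ℕ → ℤ) (f : ℕ → ℕ) (m k : ℕ) → m ≤ k → coeff (map g (applyUpTo f m)) k ≡ +0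
coeff-applyUpTo-≥ g f zero    k       _         = refl
coeff-applyUpTo-≥ g f (suc m) (suc k) (s≤s m≤k) = coeff-applyUpTo-≥ g (f ∘ suc) m k m≤k

count-oversized : ∀ {m} (f : Subset m → Bool) (L : List (Subset m)) (k : ℕ) → m < k →
  length (filter (λ S → T? (⌊ size S ≟ k ⌋ ∧ f S)) L) ≡ 0
count-oversized f []      k m<k = refl
count-oversized f (S ∷ L) k m<k with size S ≟ k
... | yes refl = ⊥-elim (<-irrefl refl (≤-<-trans (size-≤ S) m<k))
... | no _     = count-oversized f L k m<k

Dᵢ-as-gen : (G : Graph) → Dᵢ G ≈P gen (isIndDom G) size (allSubsets (n G))
Dᵢ-as-gen G .coeff-≡ k with k <? suc (n G)
... | yes k≤n = trans (coeff-applyUpTo-< (λ k → + dᵢ G k) id (suc (n G)) k k≤n)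
                      (sym (coeff-gen (isIndDom G) size (allSubsets (n G)) k))
... | no  k>n = trans (coeff-applyUpTo-≥ (λ k → + dᵢ G k) id (suc (n G)) k (≮⇒≥ k>n))
                      (sym (trans (coeff-gen (isIndDom G) size (allSubsets (n G)) k)
                                  (cong +_ (count-oversized (isIndDom G) (allSubsets (n G)) k (≮⇒≥ k>n)))))

∧-trueˡ : ∀ {a b} → a ∧ b ≡ true → a ≡ true
∧-trueˡ {true} _ = refl

∧-trueʳ : ∀ {a b} → a ∧ b ≡ true → b ≡ true
∧-trueʳ {true} e = e

∧-true : ∀ {a b} → a ≡ true → b ≡ true → a ∧ b ≡ true
∧-true refl refl = refl

≡-from-true : ∀ {a b} → (a ≡ true → b ≡ true) → (b ≡ true → a ≡ true) → a ≡ b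
≡-from-true {false} {false} _ _ = refl
≡-from-true {false} {true}  _ g = g refl
≡-from-true {true}          f _ = sym (f refl)

==F-refl : ∀ {k} (j : Fin k) → (j ==F j) ≡ true
==F-refl j with j ≟F j
... | yes _ = refl
... | no j≢j = ⊥-elim (j≢j refl)

==F-true : ∀ {k} {i j : Fin k} → (i ==F j) ≡ true → i ≡ j
==F-true {i = i} {j} e with i ≟F j
... | yes i≡j = i≡j

==F-of-≡ : ∀ {k} {i j : Fin k} → i ≡ j → (i ==F j) ≡ true
==F-of-≡ {j = j} refl = ==F-refl j

module _ {X : Set} (p : X → Bool) where

  all-tabulate⇔ : ∀ {k} (f : Fin k → X) → all p (tabulate f) ≡ true ⇔ (∀ i → p (f i) ≡ true)
  all-tabulate⇔ f = mk⇔ (forth f) (back f)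
    where
    forth : ∀ {k} (f : Fin k → X) → all p (tabulate f) ≡ true → ∀ i → p (f i) ≡ true
    forth f e zero    = ∧-trueˡ e
    forth f e (suc i) = forth (f ∘ suc) (∧-trueʳ {p (f zero)} e) i
    back : ∀ {k} (f : Fin k → X) → (∀ i → p (f i) ≡ true) → all p (tabulate f) ≡ true
    back {zero}  f h = refl
    back {suc k} f h = ∧-true (h zero) (back (f ∘ suc) (h ∘ suc))

  any-tabulate⇔ : ∀ {k} (f : Fin k → X) → any p (tabulate f) ≡ true ⇔ ∃ λ i → p (f i) ≡ true
  any-tabulate⇔ f = mk⇔ (forth f) (λ (i , e) → back f i e)
    where
    forth : ∀ {k} (f : Fin k → X) → any p (tabulate f) ≡ true → ∃ λ i → p (f i) ≡ true
    forth {suc k} f e with p (f zero) in eq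
    ... | true  = zero , eq
    ... | false with forth (f ∘ suc) e
    ... | i , h = suc i , h
    back : ∀ {k} (f : Fin k → X) i → p (f i) ≡ true → any p (tabulate f) ≡ true
    back f zero    h rewrite h = refl
    back f (suc i) h with p (f zero)
    ... | true  = refl
    ... | false = back (f ∘ suc) i h

module _ {V : Set} (E : V → V → Bool) (mem : V → Bool) where

  Independent : Set
  Independent = ∀ x y → (mem x ∧ mem y ∧ E x y) ≡ false

  Dominating : Set
  Dominating = ∀ y → mem y ≡ true ⊎ ∃ λ x → (mem x ∧ E x y) ≡ true

module _ (Γ : Graph) (S : Subset (n Γ)) where

  isIndependent⇔ : isIndependent Γ S ≡ true ⇔ Independent (adj Γ) (lookup S)
  isIndependent⇔ = mk⇔ forth back
    where
    forth : isIndependent Γ S ≡ true → Independent (adj Γ) (lookup S)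
    forth e u v = not-true (all-tabulate⇔ _ id .to (all-tabulate⇔ _ id .to e u) v)
      where
      not-true : ∀ {b} → not b ≡ true → b ≡ false
      not-true {false} _ = refl
    back : Independent (adj Γ) (lookup S) → isIndependent Γ S ≡ true
    back ind = all-tabulate⇔ _ id .from λ u → all-tabulate⇔ _ id .from λ v → cong not (ind u v)

  isDominating⇔ : isDominating Γ S ≡ true ⇔ Dominating (adj Γ) (lookup S)
  isDominating⇔ = mk⇔ forth back
    where
    forth : isDominating Γ S ≡ true → Dominating (adj Γ) (lookup S)
    forth e v with lookup S v in inS | all-tabulate⇔ _ id .to e v
    ... | true  | _        = inj₁ refl
    ... | false | hasNbr   = inj₂ (any-tabulate⇔ (λ u → lookup S u ∧ adj Γ u v) id .to hasNbr)
    back : Dominating (adj Γ) (lookup S) → isDominating Γ S ≡ true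
    back dom = all-tabulate⇔ _ id .from λ v → vertex v (dom v)
      where
      vertex : ∀ v → lookup S v ≡ true ⊎ ∃ (λ u → (lookup S u ∧ adj Γ u v) ≡ true) →
               (lookup S v ∨ any (λ u → lookup S u ∧ adj Γ u v) (tabulate id)) ≡ true
      vertex v (inj₁ inS) rewrite inS = refl
      vertex v (inj₂ (u , e)) with lookup S v
      ... | true  = refl
      ... | false = any-tabulate⇔ _ id .from (u , e)

  isIndDom⇔ : isIndDom Γ S ≡ true ⇔ (Independent (adj Γ) (lookup S) × Dominating (adj Γ) (lookup S))
  isIndDom⇔ = mk⇔
    (λ e → isIndependent⇔ .to (∧-trueˡ e) , isDominating⇔ .to (∧-trueʳ {isIndependent Γ S} e))
    (λ (ind , dom) → ∧-true (isIndependent⇔ .from ind) (isDominating⇔ .from dom))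

module Relabel {N : ℕ} {V : Set} (decode : Fin N → V) (encode : V → Fin N)
    (decode-encode : ∀ x → decode (encode x) ≡ x)
    {E : Fin N → Fin N → Bool} {E' : V → V → Bool} (E-decode : ∀ u v → E u v ≡ E' (decode u) (decode v))
    {mem : Fin N → Bool} {mem' : V → Bool} (mem-decode : ∀ i → mem i ≡ mem' (decode i)) where

  private
    mem-encode : ∀ x → mem (encode x) ≡ mem' x
    mem-encode x = trans (mem-decode (encode x)) (cong mem' (decode-encode x))

    E-encode : ∀ x y → E (encode x) (encode y) ≡ E' x y
    E-encode x y = trans (E-decode (encode x) (encode y)) (cong₂ E' (decode-encode x) (decode-encode y))

  Independent-relabel : Independent E mem ⇔ Independent E' mem'
  Independent-relabel = mk⇔
    (λ ind x y → trans (sym (cong₂ _∧_ (mem-encode x) (cong₂ _∧_ (mem-encode y) (E-encode x y)))) (ind (encode x) (encode y)))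
    (λ ind u v → trans (cong₂ _∧_ (mem-decode u) (cong₂ _∧_ (mem-decode v) (E-decode u v))) (ind (decode u) (decode v)))

  Dominating-relabel : Dominating E mem ⇔ Dominating E' mem'
  Dominating-relabel = mk⇔ forth back
    where
    forth : Dominating E mem → Dominating E' mem'
    forth dom y with dom (encode y)
    ... | inj₁ inS      = inj₁ (trans (sym (mem-encode y)) inS)
    ... | inj₂ (u , e)  = inj₂ (decode u , trans (sym (cong₂ _∧_ (mem-decode u) (trans (E-decode u (encode y)) (cong (E' (decode u)) (decode-encode y))))) e)
    back : Dominating E' mem' → Dominating E mem
    back dom v with dom (decode v)
    ... | inj₁ inS      = inj₁ (trans (mem-decode v) inS)
    ... | inj₂ (x , e)  = inj₂ (encode x , trans (cong₂ _∧_ (mem-encode x) (trans (E-decode (encode x) v) (cong (λ z → E' z (decode v)) (decode-encode x)))) e)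

count : ∀ q → (Fin q → Bool) → ℕ
count zero    h = 0
count (suc q) h = if h zero then suc (count q (h ∘ suc)) else count q (h ∘ suc)

hit : ∀ {k q} → (Fin k → Fin q) → Subset k → Fin q → Bool
hit c []      j = false
hit c (b ∷ A) j = (b ∧ (c zero ==F j)) ∨ hit (c ∘ suc) A j

hit⇔ : ∀ {k q} (c : Fin k → Fin q) (A : Subset k) j → hit c A j ≡ true ⇔ ∃ λ a → lookup A a ≡ true × c a ≡ j
hit⇔ c A j = mk⇔ (forth c A) (λ (a , inA , ca) → back c A a inA ca)
  where
  forth : ∀ {k} (c : Fin k → _) (A : Subset k) → hit c A j ≡ true → ∃ λ a → lookup A a ≡ true × c a ≡ j
  forth c (b ∷ A) e with b ∧ (c zero ==F j) in here
  ... | true  = zero , ∧-trueˡ here , ==F-true (∧-trueʳ {b} here)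
  ... | false with forth (c ∘ suc) A e
  ... | a , inA , ca = suc a , inA , ca
  back : ∀ {k} (c : Fin k → _) (A : Subset k) a → lookup A a ≡ true → c a ≡ j → hit c A j ≡ true
  back c (true ∷ A) zero refl refl rewrite ==F-refl (c zero) = refl
  back c (b ∷ A) (suc a) inA ca with b ∧ (c zero ==F j)
  ... | true  = refl
  ... | false = back (c ∘ suc) A a inA ca

count-ext : ∀ q {h h' : Fin q → Bool} → (∀ j → h j ≡ h' j) → count q h ≡ count q h'
count-ext zero    e = refl
count-ext (suc q) {h} e rewrite e zero | count-ext q {h ∘ suc} (e ∘ suc) = refl

count-none : ∀ q {h : Fin q → Bool} → (∀ j → h j ≡ false) → count q h ≡ 0
count-none zero    none = refl
count-none (suc q) {h} none rewrite none zero = count-none q (none ∘ suc)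

count-not : ∀ q (h : Fin q → Bool) → count q (not ∘ h) + count q h ≡ q
count-not zero    h = refl
count-not (suc q) h with h zero
... | true  = trans (+-suc (count q (not ∘ h ∘ suc)) _) (cong suc (count-not q (h ∘ suc)))
... | false = cong suc (count-not q (h ∘ suc))

count-∨ : ∀ q (e r : Fin q → Bool) → count q (λ j → e j ∨ r j) ≤ count q e + count q r
count-∨ zero    e r = z≤n
count-∨ (suc q) e r with e zero | r zero | count-∨ q (e ∘ suc) (r ∘ suc)
... | true  | true  | ih = s≤s (≤-trans ih (+-mono-≤ (≤-refl {count q (e ∘ suc)}) (n≤1+n _)))
... | true  | false | ih = s≤s ih
... | false | true  | ih = ≤-trans (s≤s ih) (≤-reflexive (sym (+-suc _ _)))
... | false | false | ih = ih

count-==F : ∀ q (x : Fin q) → count q (x ==F_) ≤ 1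
count-==F (suc q) zero    rewrite ==F-refl (zero {q}) | count-none q {λ j → zero ==F suc j} (λ j → refl) = s≤s z≤n
count-==F (suc q) (suc x) = ≤-trans (≤-reflexive (count-ext q (suc-==F x))) (count-==F q x)
  where
  suc-==F : ∀ {k} (x : Fin k) j → (suc x ==F suc j) ≡ (x ==F j)
  suc-==F x j with x ≟F j
  ... | yes _ = refl
  ... | no _  = refl

count-hit : ∀ {k} q (c : Fin k → Fin q) (A : Subset k) → count q (hit c A) ≤ size A
count-hit q c []          = ≤-reflexive (count-none q (λ j → refl))
count-hit q c (true ∷ A)  = ≤-trans (count-∨ q (c zero ==F_) (hit (c ∘ suc) A)) (+-mono-≤ (count-==F q (c zero)) (count-hit q (c ∘ suc) A))
count-hit q c (false ∷ A) = count-hit q (c ∘ suc) A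

take-++ : ∀ {a b} (A : Subset a) (B : Subset b) → take a (A ++V B) ≡ A
take-++ {a} A B = sym (++-injectiveˡ A _ (proj₂ (proj₂ (Vec.splitAt a (A ++V B)))))

drop-++ : ∀ {a b} (A : Subset a) (B : Subset b) → drop a (A ++V B) ≡ B
drop-++ {a} A B = sym (++-injectiveʳ A _ (proj₂ (proj₂ (Vec.splitAt a (A ++V B)))))

isEmpty : ∀ {k} → Subset k → Bool
isEmpty []      = true
isEmpty (b ∷ B) = not b ∧ isEmpty B

isEmpty⇔ : ∀ {k} (B : Subset k) → isEmpty B ≡ true ⇔ (∀ y → lookup B y ≡ false)
isEmpty⇔ B = mk⇔ (forth B) (back B)
  where
  forth : ∀ {k} (B : Subset k) → isEmpty B ≡ true → ∀ y → lookup B y ≡ false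
  forth (false ∷ B) e zero    = refl
  forth (false ∷ B) e (suc y) = forth B e y
  back : ∀ {k} (B : Subset k) → (∀ y → lookup B y ≡ false) → isEmpty B ≡ true
  back []      _     = refl
  back (b ∷ B) empty rewrite empty zero = back B (empty ∘ suc)

gen-isEmpty : ∀ k → gen isEmpty size (allSubsets k) ≈P (+ 1 ∷ [])
gen-isEmpty zero    = ≈P-refl
gen-isEmpty (suc k) = begin
  gen isEmpty size (map (true ∷_) (allSubsets k) ++ map (false ∷_) (allSubsets k))
    ≈⟨ gen-++ isEmpty size (map (true ∷_) (allSubsets k)) _ ⟩
  gen isEmpty size (map (true ∷_) (allSubsets k)) +P gen isEmpty size (map (false ∷_) (allSubsets k))
    ≡⟨ cong₂ _+P_ (trans (gen-map isEmpty size (true ∷_) (allSubsets k)) (gen-none _ _ (allSubsets k) (λ _ → refl)))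
                  (gen-map isEmpty size (false ∷_) (allSubsets k)) ⟩
  [] +P gen isEmpty size (allSubsets k)
    ≈⟨ gen-isEmpty k ⟩
  + 1 ∷ []
    ∎
  where
  open ≈P-Reasoning

-- A subset of V(H)^q (q disjoint copies of V(H), laid out consecutively)
-- splits into its q blocks.
module _ (m : ℕ) where

  blocks : ∀ q → Subset (q * m) → Vec (Subset m) q
  blocks zero    []  = []
  blocks (suc q) B = take m B ∷ blocks q (drop m B)

  concat-blocks : ∀ q (B : Subset (q * m)) → concat (blocks q B) ≡ B
  concat-blocks zero    []  = refl
  concat-blocks (suc q) B = trans (cong (take m B ++V_) (concat-blocks q (drop m B))) (take++drop≡id m B)

  lookup-blocks : ∀ q (B : Subset (q * m)) b →
    lookup B b ≡ uncurry (λ j y → lookup (lookup (blocks q B) j) y) (remQuot {q} m b)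
  lookup-blocks q B b = begin
    lookup B b                                              ≡⟨ cong₂ lookup (concat-blocks q B) (combine-remQuot {q} m b) ⟨
    lookup (concat (blocks q B)) (uncurry combine (remQuot {q} m b))
                                                            ≡⟨ lookup-concat (blocks q B) (proj₁ (remQuot {q} m b)) (proj₂ (remQuot {q} m b)) ⟩
    uncurry (λ j y → lookup (lookup (blocks q B) j) y) (remQuot {q} m b) ∎
    where open ≡-Reasoning

module _ (H : Graph) where

  -- The condition on the part of a set inside the copy H_j of H: empty when
  -- the clique C_j is hit (b = true), independent dominating in H otherwise.
  blockOK : Bool → Subset (n H) → Bool
  blockOK true  = isEmpty
  blockOK false = isIndDom H

  allBlocksOK : ∀ q → (Fin q → Bool) → Subset (q * n H) → Bool
  allBlocksOK zero    h B = true
  allBlocksOK (suc q) h B = blockOK (h zero) (take (n H) B) ∧ allBlocksOK q (h ∘ suc) (drop (n H) B)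

  allBlocksOK⇔ : ∀ q h (B : Subset (q * n H)) →
    allBlocksOK q h B ≡ true ⇔ (∀ j → blockOK (h j) (lookup (blocks (n H) q B) j) ≡ true)
  allBlocksOK⇔ q h B = mk⇔ (forth q h B) (back q h B)
    where
    forth : ∀ q h (B : Subset (q * n H)) → allBlocksOK q h B ≡ true → ∀ j → blockOK (h j) (lookup (blocks (n H) q B) j) ≡ true
    forth (suc q) h B e zero    = ∧-trueˡ e
    forth (suc q) h B e (suc j) = forth q (h ∘ suc) (drop (n H) B) (∧-trueʳ {blockOK (h zero) (take (n H) B)} e) j
    back : ∀ q h (B : Subset (q * n H)) → (∀ j → blockOK (h j) (lookup (blocks (n H) q B) j) ≡ true) → allBlocksOK q h B ≡ true
    back zero    h B ok = refl
    back (suc q) h B ok = ∧-true (ok zero) (back q (h ∘ suc) (drop (n H) B) (ok ∘ suc))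

  gen-blockOK : ∀ b c → gen (blockOK b) size (allSubsets (n H)) *P (Dᵢ H ^P c)
                          ≈P Dᵢ H ^P (if not b then suc c else c)
  gen-blockOK true  c = ≈P-trans (*P-congˡ _ _ (Dᵢ H ^P c) (gen-isEmpty (n H))) (*P-identityˡ (Dᵢ H ^P c))
  gen-blockOK false c = *P-congˡ _ _ (Dᵢ H ^P c) (≈P-sym (Dᵢ-as-gen H))

  -- Blocks are chosen independently, so their generating polynomials multiply:
  -- every free clique contributes a factor Dᵢ(H).
  gen-allBlocksOK : ∀ q h → gen (allBlocksOK q h) size (allSubsets (q * n H)) ≈P Dᵢ H ^P count q (not ∘ h)
  gen-allBlocksOK zero    h = coeffwise λ { zero → refl ; (suc k) → refl }
  gen-allBlocksOK (suc q) h = begin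
    gen (allBlocksOK (suc q) h) size (allSubsets (n H + q * n H))
      ≡⟨ cong (gen (allBlocksOK (suc q) h) size) (allSubsets-+ (n H) (q * n H)) ⟩
    gen (allBlocksOK (suc q) h) size (map append (pairs (allSubsets (n H)) (allSubsets (q * n H))))
      ≡⟨ gen-map (allBlocksOK (suc q) h) size append (pairs (allSubsets (n H)) (allSubsets (q * n H))) ⟩
    gen (allBlocksOK (suc q) h ∘ append) (size ∘ append) (pairs (allSubsets (n H)) (allSubsets (q * n H)))
      ≡⟨ gen-ext (pairs (allSubsets (n H)) (allSubsets (q * n H)))
           (λ (A , B) → cong₂ (λ X Y → blockOK (h zero) X ∧ allBlocksOK q (h ∘ suc) Y) (take-++ A B) (drop-++ A B))
           (λ (A , B) → size-++ A B) ⟩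
    gen (λ AB → blockOK (h zero) (proj₁ AB) ∧ allBlocksOK q (h ∘ suc) (proj₂ AB)) (λ AB → size (proj₁ AB) + size (proj₂ AB))
        (pairs (allSubsets (n H)) (allSubsets (q * n H)))
      ≈⟨ gen-pairs-× (blockOK (h zero)) size (allBlocksOK q (h ∘ suc)) size (allSubsets (n H)) (allSubsets (q * n H)) ⟩
    gen (blockOK (h zero)) size (allSubsets (n H)) *P gen (allBlocksOK q (h ∘ suc)) size (allSubsets (q * n H))
      ≈⟨ *P-congʳ (gen (blockOK (h zero)) size (allSubsets (n H))) (gen-allBlocksOK q (h ∘ suc)) ⟩
    gen (blockOK (h zero)) size (allSubsets (n H)) *P (Dᵢ H ^P count q (not ∘ h ∘ suc))
      ≈⟨ gen-blockOK (h zero) (count q (not ∘ h ∘ suc)) ⟩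
    Dᵢ H ^P count (suc q) (not ∘ h)
      ∎
    where open ≈P-Reasoning

module CompoundIDS (G H : Graph) {q : ℕ} (𝒞 : CliqueCover G q) where

  Vertex : Set
  Vertex = Fin (n G) ⊎ (Fin q × Fin (n H))

  decode : Fin (n G + q * n H) → Vertex
  decode = [ inj₁ , inj₂ ∘ remQuot (n H) ]′ ∘ splitAt (n G)

  encode : Vertex → Fin (n G + q * n H)
  encode (inj₁ a)       = join (n G) (q * n H) (inj₁ a)
  encode (inj₂ (j , y)) = join (n G) (q * n H) (inj₂ (combine j y))

  decode-encode : ∀ x → decode (encode x) ≡ x
  decode-encode (inj₁ a)       = cong [ inj₁ , inj₂ ∘ remQuot (n H) ]′ (splitAt-join (n G) (q * n H) (inj₁ a))
  decode-encode (inj₂ (j , y)) = trans (cong [ inj₁ , inj₂ ∘ remQuot (n H) ]′ (splitAt-join (n G) (q * n H) (inj₂ (combine j y))))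
                                       (cong inj₂ (remQuot-combine j y))

  adjΔ : Vertex → Vertex → Bool
  adjΔ (inj₁ a)       (inj₁ b)        = adj G a b
  adjΔ (inj₁ a)       (inj₂ (j , y))  = cls 𝒞 a ==F j
  adjΔ (inj₂ (j , x)) (inj₁ b)        = cls 𝒞 b ==F j
  adjΔ (inj₂ (j , x)) (inj₂ (j' , y)) = (j ==F j') ∧ adj H x y

  adj-decode : ∀ u v → adj (compound G H 𝒞) u v ≡ adjΔ (decode u) (decode v)
  adj-decode u v with splitAt (n G) u | splitAt (n G) v
  ... | inj₁ _ | inj₁ _ = refl
  ... | inj₁ _ | inj₂ _ = refl
  ... | inj₂ _ | inj₁ _ = refl
  ... | inj₂ _ | inj₂ _ = refl

  hitsClique : Subset (n G) → Fin q → Bool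
  hitsClique A = hit (cls 𝒞) A

  module _ (A : Subset (n G)) (B : Subset (q * n H)) where

    block : Fin q → Subset (n H)
    block = lookup (blocks (n H) q B)

    member : Vertex → Bool
    member (inj₁ a)       = lookup A a
    member (inj₂ (j , y)) = lookup (block j) y

    lookup-decode : ∀ i → lookup (A ++V B) i ≡ member (decode i)
    lookup-decode i = trans (lookup-splitAt (n G) A B i) (on-parts (splitAt (n G) i))
      where
      on-parts : ∀ s → [ lookup A , lookup B ]′ s ≡ member ([ inj₁ , inj₂ ∘ remQuot (n H) ]′ s)
      on-parts (inj₁ a) = refl
      on-parts (inj₂ b) = lookup-blocks (n H) q B b

    BlocksOK : Set
    BlocksOK = ∀ j → blockOK H (hitsClique A j) (block j) ≡ true

    private
      true≢false : true ≡ false → ∀ {ℓ} {P : Set ℓ} → P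
      true≢false ()

      ∧-false-middle : ∀ {x y z} → x ≡ true → z ≡ true → (x ∧ y ∧ z) ≡ false → y ≡ false
      ∧-false-middle {y = false} _    _    _  = refl
      ∧-false-middle {y = true}  refl refl ()

    -- Necessity: a block under a hit clique is empty (its vertices are
    -- adjacent to the hitting vertex); a block under a free clique must be
    -- independent and dominate its copy of H on its own.
    blocks-of-IDS : Independent adjΔ member → Dominating adjΔ member → BlocksOK
    blocks-of-IDS ind dom j with hitsClique A j in hitJ
    ... | true with hit⇔ (cls 𝒞) A j .to hitJ
    ...   | a , inA , ca = isEmpty⇔ (block j) .from λ y → ∧-false-middle inA (==F-of-≡ ca) (ind (inj₁ a) (inj₂ (j , y)))
    blocks-of-IDS ind dom j | false = isIndDom⇔ H (block j) .from (ind-H , dom-H)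
      where
      ind-H : Independent (adj H) (lookup (block j))
      ind-H x y = subst (λ t → (lookup (block j) x ∧ lookup (block j) y ∧ (t ∧ adj H x y)) ≡ false)
                        (==F-refl j) (ind (inj₂ (j , x)) (inj₂ (j , y)))
      dom-H : Dominating (adj H) (lookup (block j))
      dom-H y with dom (inj₂ (j , y))
      ... | inj₁ inB = inj₁ inB
      ... | inj₂ (inj₁ a , e) = true≢false (trans (sym (hit⇔ (cls 𝒞) A j .from (a , ∧-trueˡ e , ==F-true (∧-trueʳ {lookup A a} e)))) hitJ)
      ... | inj₂ (inj₂ (j' , x) , e) with ==F-true {i = j'} {j = j} (∧-trueˡ (∧-trueʳ {lookup (block j') x} e))
      ...   | refl = inj₂ (x , ∧-true (∧-trueˡ e) (∧-trueʳ {j ==F j} (∧-trueʳ {lookup (block j) x} e)))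

    module _ (ok : BlocksOK) where

      empty-if-hit : ∀ j → hitsClique A j ≡ true → ∀ y → lookup (block j) y ≡ false
      empty-if-hit j hitJ = isEmpty⇔ (block j) .to (subst (λ b → blockOK H b (block j) ≡ true) hitJ (ok j))

      IDS-if-free : ∀ j → hitsClique A j ≡ false →
        Independent (adj H) (lookup (block j)) × Dominating (adj H) (lookup (block j))
      IDS-if-free j freeJ = isIndDom⇔ H (block j) .to (subst (λ b → blockOK H b (block j) ≡ true) freeJ (ok j))

      -- Sufficiency, independence: edges inside V(G) are excluded by A,
      -- edges inside a copy by its block, and edges from C_j to H_j because
      -- the block of a hit clique is empty.
      independent-of-blocks : Independent (adj G) (lookup A) → Independent adjΔ member
      independent-of-blocks indA (inj₁ a) (inj₁ b) = indA a b
      independent-of-blocks indA (inj₁ a) (inj₂ (j , y)) with lookup A a in inA | cls 𝒞 a ==F j in ca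
      ... | false | _     = refl
      ... | true  | false = ∧-zeroʳ (lookup (block j) y)
      ... | true  | true  rewrite empty-if-hit j (hit⇔ (cls 𝒞) A j .from (a , inA , ==F-true ca)) y = refl
      independent-of-blocks indA (inj₂ (j , x)) (inj₁ b) with lookup (block j) x in inB | lookup A b in inA | cls 𝒞 b ==F j in cb
      ... | false | _     | _     = refl
      ... | true  | false | _     = refl
      ... | true  | true  | false = refl
      ... | true  | true  | true  = true≢false (trans (sym inB) (empty-if-hit j (hit⇔ (cls 𝒞) A j .from (b , inA , ==F-true cb)) x))
      independent-of-blocks indA (inj₂ (j , x)) (inj₂ (j' , y)) with j ==F j' in jj
      ... | false rewrite ∧-zeroʳ (lookup (block j') y) = ∧-zeroʳ (lookup (block j) x)
      ... | true with ==F-true {i = j} {j = j'} jj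
      ...   | refl with hitsClique A j in hitJ
      ...     | true  rewrite empty-if-hit j hitJ x = refl
      ...     | false = proj₁ (IDS-if-free j hitJ) x y

      -- Sufficiency, domination: a vertex of C_j is dominated by the vertex
      -- of A hitting C_j (a clique), or else by the nonempty block of H_j;
      -- a vertex of H_j by the hitting vertex, or else within its block.
      dominating-of-blocks : Fin (n H) → Dominating adjΔ member
      dominating-of-blocks v₀ (inj₁ a) with lookup A a in inA
      ... | true  = inj₁ refl
      ... | false with hitsClique A (cls 𝒞 a) in hitJ
      ...   | true with hit⇔ (cls 𝒞) A (cls 𝒞 a) .to hitJ
      ...     | a' , inA' , ca' with clique 𝒞 a' a ca'
      ...       | inj₁ refl = true≢false (trans (sym inA') inA)
      ...       | inj₂ adjT = inj₂ (inj₁ a' , ∧-true inA' adjT)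
      dominating-of-blocks v₀ (inj₁ a) | false | false =
        inj₂ (inj₂ (cls 𝒞 a , proj₁ witness) , ∧-true (proj₂ witness) (==F-refl (cls 𝒞 a)))
        where
        witness : ∃ λ y → lookup (block (cls 𝒞 a)) y ≡ true
        witness with proj₂ (IDS-if-free (cls 𝒞 a) hitJ) v₀
        ... | inj₁ inB     = v₀ , inB
        ... | inj₂ (y , e) = y , ∧-trueˡ e
      dominating-of-blocks v₀ (inj₂ (j , y)) with lookup (block j) y in inB
      ... | true  = inj₁ refl
      ... | false with hitsClique A j in hitJ
      ...   | true with hit⇔ (cls 𝒞) A j .to hitJ
      ...     | a , inA , ca = inj₂ (inj₁ a , ∧-true inA (==F-of-≡ ca))
      dominating-of-blocks v₀ (inj₂ (j , y)) | false | false with proj₂ (IDS-if-free j hitJ) y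
      ... | inj₁ inB'     = true≢false (trans (sym inB') inB)
      ... | inj₂ (x , e)  = inj₂ (inj₂ (j , x) , ∧-true (∧-trueˡ {lookup (block j) x} e) (∧-true (==F-refl j) (∧-trueʳ {lookup (block j) x} e)))

    isIndDom-compound : Fin (n H) →
      isIndDom (compound G H 𝒞) (A ++V B) ≡ (isIndependent G A ∧ allBlocksOK H q (hitsClique A) B)
    isIndDom-compound v₀ = ≡-from-true necessary sufficient
      where
      open Relabel decode encode decode-encode {E' = adjΔ} adj-decode {mem' = member} lookup-decode

      necessary : isIndDom (compound G H 𝒞) (A ++V B) ≡ true → (isIndependent G A ∧ allBlocksOK H q (hitsClique A) B) ≡ true
      necessary e = ∧-true (isIndependent⇔ G A .from λ a b → ind (inj₁ a) (inj₁ b)) (allBlocksOK⇔ H q (hitsClique A) B .from (blocks-of-IDS ind dom))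
        where
        ind = Independent-relabel .to (proj₁ (isIndDom⇔ (compound G H 𝒞) (A ++V B) .to e))
        dom = Dominating-relabel .to (proj₂ (isIndDom⇔ (compound G H 𝒞) (A ++V B) .to e))

      sufficient : (isIndependent G A ∧ allBlocksOK H q (hitsClique A) B) ≡ true → isIndDom (compound G H 𝒞) (A ++V B) ≡ true
      sufficient e = isIndDom⇔ (compound G H 𝒞) (A ++V B) .from
        ( Independent-relabel .from (independent-of-blocks ok (isIndependent⇔ G A .to (∧-trueˡ e)))
        , Dominating-relabel .from (dominating-of-blocks ok v₀) )
        where
        ok = allBlocksOK⇔ H q (hitsClique A) B .to (∧-trueʳ {isIndependent G A} e)

module Factorisation (G H : Graph) {q : ℕ} (𝒞 : CliqueCover G q) (v₀ : Fin (n H)) where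
  open CompoundIDS G H 𝒞

  free : Subset (n G) → ℕ
  free A = count q (not ∘ hitsClique A)

  -- An independent set meets at most α(G) cliques, leaving at least q − α(G) free.
  free-bound : ∀ A → isIndependent G A ≡ true → q ∸ α G ≤ free A
  free-bound A ind = ≤-trans (∸-monoʳ-≤ q (≤-trans (count-hit q (cls 𝒞) A) (α-bound G A ind)))
                             (≤-reflexive (trans (cong (_∸ count q (hitsClique A)) (sym (count-not q (hitsClique A))))
                                                 (m+n∸n≡m (free A) (count q (hitsClique A)))))

  Dᵢ-compound : Dᵢ (compound G H 𝒞) ≈P
    sumP (λ A → if isIndependent G A then shiftP (size A) (Dᵢ H ^P free A) else []) (allSubsets (n G))
  Dᵢ-compound = begin
    Dᵢ (compound G H 𝒞)
      ≈⟨ Dᵢ-as-gen (compound G H 𝒞) ⟩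
    gen (isIndDom (compound G H 𝒞)) size (allSubsets (n G + q * n H))
      ≡⟨ cong (gen (isIndDom (compound G H 𝒞)) size) (allSubsets-+ (n G) (q * n H)) ⟩
    gen (isIndDom (compound G H 𝒞)) size (map append (pairs As Bs))
      ≡⟨ gen-map (isIndDom (compound G H 𝒞)) size append (pairs As Bs) ⟩
    gen (isIndDom (compound G H 𝒞) ∘ append) (size ∘ append) (pairs As Bs)
      ≡⟨ gen-ext (pairs As Bs) (λ (A , B) → isIndDom-compound A B v₀) (λ (A , B) → size-++ A B) ⟩
    gen (λ AB → isIndependent G (proj₁ AB) ∧ allBlocksOK H q (hitsClique (proj₁ AB)) (proj₂ AB))
        (λ AB → size (proj₁ AB) + size (proj₂ AB)) (pairs As Bs)
      ≈⟨ gen-pairs (isIndependent G) size (λ A → allBlocksOK H q (hitsClique A)) size As Bs ⟩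
    sumP (λ A → if isIndependent G A then shiftP (size A) (gen (allBlocksOK H q (hitsClique A)) size Bs) else []) As
      ≈⟨ sumP-cong As (λ A → if-cong (isIndependent G A) (shiftP-cong (size A) (gen-allBlocksOK H q (hitsClique A)))) ⟩
    sumP (λ A → if isIndependent G A then shiftP (size A) (Dᵢ H ^P free A) else []) As
      ∎
    where
    open ≈P-Reasoning
    As = allSubsets (n G)
    Bs = allSubsets (q * n H)
    if-cong : ∀ b {p p'} → p ≈P p' → (if b then p else []) ≈P (if b then p' else [])
    if-cong true  e = e
    if-cong false e = ≈P-refl

  cofactor : Subset (n G) → Poly
  cofactor A = if isIndependent G A then shiftP (size A) (Dᵢ H ^P (free A ∸ (q ∸ α G))) else []

  summand-factor : ∀ A → (if isIndependent G A then shiftP (size A) (Dᵢ H ^P free A) else [])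
                           ≈P (Dᵢ H ^P (q ∸ α G)) *P cofactor A
  summand-factor A with isIndependent G A in ind
  ... | false = ≈P-sym (*P-zeroʳ (Dᵢ H ^P (q ∸ α G)))
  ... | true  = begin
    shiftP (size A) (Dᵢ H ^P free A)
      ≡⟨ cong (λ e → shiftP (size A) (Dᵢ H ^P e)) (sym (m+[n∸m]≡n (free-bound A ind))) ⟩
    shiftP (size A) (Dᵢ H ^P (M + (free A ∸ M)))
      ≈⟨ shiftP-cong (size A) (^P-+ (Dᵢ H) M (free A ∸ M)) ⟩
    shiftP (size A) ((Dᵢ H ^P M) *P (Dᵢ H ^P (free A ∸ M)))
      ≈⟨ shiftP-*P (size A) (Dᵢ H ^P M) (Dᵢ H ^P (free A ∸ M)) ⟩
    (Dᵢ H ^P M) *P shiftP (size A) (Dᵢ H ^P (free A ∸ M))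
      ∎
    where
    open ≈P-Reasoning
    M = q ∸ α G

  divides : Dᵢ (compound G H 𝒞) ≈P (Dᵢ H ^P (q ∸ α G)) *P sumP cofactor (allSubsets (n G))
  divides = begin
    Dᵢ (compound G H 𝒞)
      ≈⟨ Dᵢ-compound ⟩
    sumP (λ A → if isIndependent G A then shiftP (size A) (Dᵢ H ^P free A) else []) (allSubsets (n G))
      ≈⟨ sumP-cong (allSubsets (n G)) summand-factor ⟩
    sumP (λ A → (Dᵢ H ^P (q ∸ α G)) *P cofactor A) (allSubsets (n G))
      ≈⟨ sumP-factor (Dᵢ H ^P (q ∸ α G)) cofactor (allSubsets (n G)) ⟩
    (Dᵢ H ^P (q ∸ α G)) *P sumP cofactor (allSubsets (n G))
      ∎
    where open ≈P-Reasoning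

mainTheorem5 : (G H : Graph) → (m : ℕ) → n H ≡ suc m → (q : ℕ) → (𝒞 : CliqueCover G q) →
  (Dᵢ H ^P (q ∸ α G)) ∣P Dᵢ (compound G H 𝒞)
mainTheorem5 G H m nH≡1+m q 𝒞 = sumP cofactor (allSubsets (n G)) , divides .coeff-≡
  where open Factorisation G H 𝒞 (subst Fin (sym nH≡1+m) zero)
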